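{- Let $I$ be an independent set in a claw-free graph $G$ that is not a maximum independent set. Then for every independent set $J$ of $G$ with $|J|=|I|$, $I\leftrightarrow_{\mathrm{TJ}} J$.
   Context: Graphs are finite and simple; claw-free means no induced $K_{1,3}$. A TJ-sequence is a sequence $I_0,\ldots,I_m$ of independent sets such that for each $i$ there are vertices $u,v$ with $I_i\setminus I_{i+1}=\{u\}$, $I_{i+1}\setminus I_i=\{v\}$; $I\leftrightarrow_{\mathrm{TJ}} J$ means a TJ-sequence from $I$ to $J$ exists. -}

module Defs where

open import Data.Nat using (ℕ; _<_)
open import Data.Fin using (Fin)
open import Data.Fin.Subset using (Subset; _∈_; _∉_; ∣_∣)
open import Data.Product using (Σ; ∃; ∃-syntax; _×_)
open import Relation.Nullary using (¬_; Dec)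
open import Relation.Binary.PropositionalEquality using (_≡_; _≢_)
open import Relation.Binary.Construct.Closure.ReflexiveTransitive using (Star)
open import Function.Bundles using (_⇔_)
open import Level using (0ℓ)
import Data.Empty
import Data.Nat

record Graph (n : ℕ) : Set₁ where
  field
    Adj      : Fin n → Fin n → Set
    adj-dec  : ∀ x y → Dec (Adj x y)
    adj-sym  : ∀ {x y} → Adj x y → Adj y x
    adj-irr  : ∀ {x} → ¬ Adj x x
open Graph public

module _ {n : ℕ} (G : Graph n) where

  Independent : Subset n → Set
  Independent I = ∀ {x y} → x ∈ I → y ∈ I → ¬ Adj G x y

  MaximumIndependent : Subset n → Set
  MaximumIndependent I = Independent I × (∀ K → Independent K → ∣ K ∣ Data.Nat.≤ ∣ I ∣)

  ClawFree : Set
  ClawFree = ∀ c a b d → Adj G c a → Adj G c b → Adj G c d →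
             ¬ Adj G a b → ¬ Adj G a d → ¬ Adj G b d →
             a ≢ b → a ≢ d → b ≢ d → Data.Empty.⊥

  TJStep : Subset n → Subset n → Set
  TJStep I J = Independent I × Independent J ×
    ∃[ u ] ∃[ v ] (∀ x → ((x ∈ I × x ∉ J) ⇔ (x ≡ u)))
                × (∀ x → ((x ∈ J × x ∉ I) ⇔ (x ≡ v)))

  TJReachable : Subset n → Subset n → Set
  TJReachable = Star TJStep

-- Since I is not maximum, there is an independent set K with |I| < |K|. An
-- independent set I can always be pushed by TJ-steps into an independent set T
-- with |I| < |T|: while I ⊈ T, some v ∈ T ∖ I has at most one neighbour in I ∖ T
-- (and none in I ∩ T, as T is independent), so a token can jump to v from that
-- neighbour, or from anywhere in I ∖ T, shrinking I ∖ T. Such a v exists by double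
-- counting the edges between T ∖ I and I ∖ T: in a claw-free graph a vertex has at
-- most two pairwise non-adjacent neighbours, so every vertex of I ∖ T has at most
-- two of them, and if every vertex of T ∖ I had two we would get |T ∖ I| ≤ |I ∖ T|,
-- i.e. |T| ≤ |I|. Thus I and J are pushed into subsets I₁, J₁ of K of equal size;
-- inside K there are no edges at all, so I₁ reaches J₁ the same way.

module Submission where

open import Data.Bool using (Bool; true; false; _∧_)
open import Data.Bool.Properties using (∧-assoc; ∧-comm)
open import Data.Empty using (⊥-elim)
open import Data.Fin using (Fin; zero; suc; _≟_)
open import Data.Fin.Properties using (any?; all?)
open import Data.Fin.Subset
open import Data.Fin.Subset.Properties
open import Data.Nat using (ℕ; zero; suc; _+_; _*_; _≤_; _<_; z≤n; s≤s; s≤s⁻¹; _≤?_; _<?_)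
open import Data.Nat.Induction using (<-wellFounded)
open import Data.Nat.Properties hiding (_≟_)
open import Algebra.Properties.CommutativeMonoid.Sum +-0-commutativeMonoid
  using (sum-syntax; ∑-comm; sum-cong-≗; sum-replicate-zero)
open import Algebra.Properties.Semiring.Sum +-*-semiring using (*-distribʳ-sum)
open import Data.Product using (_×_; _,_; ∃; ∃₂; proj₁; proj₂)
open import Data.Sum using (_⊎_; inj₁; inj₂)
open import Data.Vec using ([]; _∷_; here; there; lookup; tabulate)
open import Data.Vec.Properties using (lookup∘tabulate; lookup-zipWith; lookup⇒[]=; []=⇒lookup)
open import Function.Base using (_∘_)
open import Function.Bundles using (_⇔_; mk⇔; Equivalence)
open import Induction.WellFounded using (Acc; acc)
open import Relation.Binary.Construct.Closure.ReflexiveTransitive using (ε; _◅_; _◅◅_; reverse)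
open import Relation.Binary.PropositionalEquality
open import Relation.Nullary using (¬_; Dec; yes; no; does; contradiction)
open import Relation.Nullary.Decidable using (_×-dec_; _→-dec_; ¬?; map′; does-⇔; dec-true)

open import Defs

private variable
  n k : ℕ
  p q : Subset n
  x y : Fin n

x∈p─q⇒x∉q : x ∈ p ─ q → x ∉ q
x∈p─q⇒x∉q {p = _ ∷ _} {outside ∷ _} (there x∈) (there x∈q) = x∈p─q⇒x∉q x∈ x∈q
x∈p─q⇒x∉q {p = _ ∷ _} {inside ∷ _} (there x∈) (there x∈q) = x∈p─q⇒x∉q x∈ x∈q

x∈p─q⇔ : x ∈ p ─ q ⇔ (x ∈ p × x ∉ q)
x∈p─q⇔ {p = p} {q} = mk⇔ (λ x∈ → p─q⊆p p q x∈ , x∈p─q⇒x∉q x∈) λ (x∈p , x∉q) → x∈p∧x∉q⇒x∈p─q x∈p x∉q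

∣p∣≡∣p∩q∣+∣p─q∣ : ∀ (p q : Subset n) → ∣ p ∣ ≡ ∣ p ∩ q ∣ + ∣ p ─ q ∣
∣p∣≡∣p∩q∣+∣p─q∣ [] [] = refl
∣p∣≡∣p∩q∣+∣p─q∣ (outside ∷ p) (inside ∷ q) = ∣p∣≡∣p∩q∣+∣p─q∣ p q
∣p∣≡∣p∩q∣+∣p─q∣ (outside ∷ p) (outside ∷ q) = ∣p∣≡∣p∩q∣+∣p─q∣ p q
∣p∣≡∣p∩q∣+∣p─q∣ (inside ∷ p) (inside ∷ q) = cong suc (∣p∣≡∣p∩q∣+∣p─q∣ p q)
∣p∣≡∣p∩q∣+∣p─q∣ (inside ∷ p) (outside ∷ q) =
  trans (cong suc (∣p∣≡∣p∩q∣+∣p─q∣ p q)) (sym (+-suc ∣ p ∩ q ∣ ∣ p ─ q ∣))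

∣p∣+∣q─p∣≡∣q∣+∣p─q∣ : ∀ (p q : Subset n) → ∣ p ∣ + ∣ q ─ p ∣ ≡ ∣ q ∣ + ∣ p ─ q ∣
∣p∣+∣q─p∣≡∣q∣+∣p─q∣ p q = begin
  ∣ p ∣ + ∣ q ─ p ∣                   ≡⟨ cong (_+ ∣ q ─ p ∣) (∣p∣≡∣p∩q∣+∣p─q∣ p q) ⟩
  ∣ p ∩ q ∣ + ∣ p ─ q ∣ + ∣ q ─ p ∣   ≡⟨ cong (λ r → ∣ r ∣ + ∣ p ─ q ∣ + ∣ q ─ p ∣) (∩-comm p q) ⟩
  ∣ q ∩ p ∣ + ∣ p ─ q ∣ + ∣ q ─ p ∣   ≡⟨ +-assoc ∣ q ∩ p ∣ _ _ ⟩
  ∣ q ∩ p ∣ + (∣ p ─ q ∣ + ∣ q ─ p ∣) ≡⟨ cong (∣ q ∩ p ∣ +_) (+-comm ∣ p ─ q ∣ _) ⟩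
  ∣ q ∩ p ∣ + (∣ q ─ p ∣ + ∣ p ─ q ∣) ≡⟨ +-assoc ∣ q ∩ p ∣ _ _ ⟨
  ∣ q ∩ p ∣ + ∣ q ─ p ∣ + ∣ p ─ q ∣   ≡⟨ cong (_+ ∣ p ─ q ∣) (∣p∣≡∣p∩q∣+∣p─q∣ q p) ⟨
  ∣ q ∣ + ∣ p ─ q ∣                   ∎
  where open ≡-Reasoning

∣p∣<∣q∣⇒∣p─q∣<∣q─p∣ : ∀ (p q : Subset n) → ∣ p ∣ < ∣ q ∣ → ∣ p ─ q ∣ < ∣ q ─ p ∣
∣p∣<∣q∣⇒∣p─q∣<∣q─p∣ p q ∣p∣<∣q∣ = ≰⇒> λ ∣q─p∣≤∣p─q∣ →
  <-irrefl (∣p∣+∣q─p∣≡∣q∣+∣p─q∣ p q) (+-mono-<-≤ ∣p∣<∣q∣ ∣q─p∣≤∣p─q∣)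

∣p∣≡∣q∣⇒∣p─q∣≡∣q─p∣ : ∀ (p q : Subset n) → ∣ p ∣ ≡ ∣ q ∣ → ∣ p ─ q ∣ ≡ ∣ q ─ p ∣
∣p∣≡∣q∣⇒∣p─q∣≡∣q─p∣ p q ∣p∣≡∣q∣ = sym (+-cancelˡ-≡ ∣ p ∣ _ _
  (trans (∣p∣+∣q─p∣≡∣q∣+∣p─q∣ p q) (cong (_+ ∣ p ─ q ∣) (sym ∣p∣≡∣q∣))))

Empty[p─q]⇒p⊆q : ∀ (p q : Subset n) → Empty (p ─ q) → p ⊆ q
Empty[p─q]⇒p⊆q p q empty {x} x∈p with x ∈? q
... | yes x∈q = x∈q
... | no x∉q = ⊥-elim (empty (x , x∈p∧x∉q⇒x∈p─q x∈p x∉q))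

∣p∣>0⇒Nonempty : 0 < ∣ p ∣ → Nonempty p
∣p∣>0⇒Nonempty {p = inside ∷ p} _ = zero , here
∣p∣>0⇒Nonempty {p = outside ∷ p} 0<∣p∣ with ∣p∣>0⇒Nonempty 0<∣p∣
... | x , x∈p = suc x , there x∈p

Empty⇒∣p∣≡0 : Empty p → ∣ p ∣ ≡ 0
Empty⇒∣p∣≡0 {n} empty rewrite Empty-unique empty = ∣⊥∣≡0 n

x∈p⇒∣p∣≡1+∣p-x∣ : ∀ (p : Subset n) → x ∈ p → ∣ p ∣ ≡ suc ∣ p - x ∣
x∈p⇒∣p∣≡1+∣p-x∣ {x = x} p x∈p = begin
  ∣ p ∣                     ≡⟨ ∣p∣≡∣p∩q∣+∣p─q∣ p ⁅ x ⁆ ⟩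
  ∣ p ∩ ⁅ x ⁆ ∣ + ∣ p - x ∣ ≡⟨ cong (λ r → ∣ r ∣ + ∣ p - x ∣) p∩⁅x⁆≡⁅x⁆ ⟩
  ∣ ⁅ x ⁆ ∣ + ∣ p - x ∣     ≡⟨ cong (_+ ∣ p - x ∣) (∣⁅x⁆∣≡1 x) ⟩
  suc ∣ p - x ∣             ∎
  where
  open ≡-Reasoning
  p∩⁅x⁆≡⁅x⁆ : p ∩ ⁅ x ⁆ ≡ ⁅ x ⁆
  p∩⁅x⁆≡⁅x⁆ = ⊆-antisym (p∩q⊆q p ⁅ x ⁆)
    λ y∈⁅x⁆ → x∈p∩q⁺ (subst (_∈ p) (sym (x∈⁅y⁆⇒x≡y x y∈⁅x⁆)) x∈p , y∈⁅x⁆)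

x∈p-y⇒x≢y : ∀ (p : Subset n) → x ∈ p - y → x ≢ y
x∈p-y⇒x≢y {y = y} p x∈p-y = x∉⁅y⁆⇒x≢y (x∈p─q⇒x∉q {p = p} x∈p-y)

x∈p⇒0<∣p∣ : ∀ (p : Subset n) → x ∈ p → 0 < ∣ p ∣
x∈p⇒0<∣p∣ p x∈p rewrite x∈p⇒∣p∣≡1+∣p-x∣ p x∈p = s≤s z≤n

k<∣p∣⇒∃x∈p[k≤∣p-x∣] : ∀ (p : Subset n) → k < ∣ p ∣ → ∃ λ x → x ∈ p × k ≤ ∣ p - x ∣
k<∣p∣⇒∃x∈p[k≤∣p-x∣] p k<∣p∣ with ∣p∣>0⇒Nonempty {p = p} (≤-trans (s≤s z≤n) k<∣p∣)
... | x , x∈p rewrite x∈p⇒∣p∣≡1+∣p-x∣ p x∈p = x , x∈p , s≤s⁻¹ k<∣p∣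

∣p∣≤1⇒x≡y : ∀ (p : Subset n) → ∣ p ∣ ≤ 1 → x ∈ p → y ∈ p → x ≡ y
∣p∣≤1⇒x≡y {x = x} {y} p ∣p∣≤1 x∈p y∈p with y ≟ x
... | yes y≡x = sym y≡x
... | no y≢x = contradiction ∣p∣≤1 (<⇒≱ (begin-strict
  1             <⟨ s≤s (x∈p⇒0<∣p∣ (p - x) (x∈p∧x≢y⇒x∈p-y y∈p y≢x)) ⟩
  suc ∣ p - x ∣ ≡⟨ x∈p⇒∣p∣≡1+∣p-x∣ p x∈p ⟨
  ∣ p ∣         ∎))
  where open ≤-Reasoning

3≤∣p∣⇒three-distinct : ∀ (p : Subset n) → 3 ≤ ∣ p ∣ →
                       ∃₂ λ x y → ∃ λ z → x ∈ p × y ∈ p × z ∈ p × x ≢ y × x ≢ z × y ≢ z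
3≤∣p∣⇒three-distinct p 3≤∣p∣ =
  let x , x∈p , 2≤∣p-x∣ = k<∣p∣⇒∃x∈p[k≤∣p-x∣] p 3≤∣p∣
      y , y∈p-x , 1≤∣p-x-y∣ = k<∣p∣⇒∃x∈p[k≤∣p-x∣] (p - x) 2≤∣p-x∣
      z , z∈p-x-y , _ = k<∣p∣⇒∃x∈p[k≤∣p-x∣] (p - x - y) 1≤∣p-x-y∣
      z∈p-x = p─q⊆p (p - x) ⁅ y ⁆ z∈p-x-y
  in x , y , z , x∈p , p─q⊆p p ⁅ x ⁆ y∈p-x , p─q⊆p p ⁅ x ⁆ z∈p-x ,
     ≢-sym (x∈p-y⇒x≢y p y∈p-x) , ≢-sym (x∈p-y⇒x≢y p z∈p-x) , ≢-sym (x∈p-y⇒x≢y (p - x) z∈p-x-y)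

p⊆q⇒∣p∣≡∣q∣⇒p≡q : ∀ (p q : Subset n) → p ⊆ q → ∣ p ∣ ≡ ∣ q ∣ → p ≡ q
p⊆q⇒∣p∣≡∣q∣⇒p≡q p q p⊆q ∣p∣≡∣q∣ = ⊆-antisym p⊆q q⊆p
  where
  q⊆p : q ⊆ p
  q⊆p {x} x∈q with x ∈? p
  ... | yes x∈p = x∈p
  ... | no x∉p = contradiction (p⊂q⇒∣p∣<∣q∣ (p⊆q , x , x∈q , x∉p)) (<-irrefl ∣p∣≡∣q∣)

∣p─q∣≡1 : ∀ (p q : Subset n) {u} → (∀ x → (x ∈ p × x ∉ q) ⇔ x ≡ u) → ∣ p ─ q ∣ ≡ 1
∣p─q∣≡1 p q {u} p─q≡u = trans (cong ∣_∣ p─q≡⁅u⁆) (∣⁅x⁆∣≡1 u)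
  where
  p─q≡⁅u⁆ : p ─ q ≡ ⁅ u ⁆
  p─q≡⁅u⁆ = ⊆-antisym
    (λ {x} x∈p─q → subst (_∈ ⁅ u ⁆) (sym (Equivalence.to (p─q≡u x) (Equivalence.to x∈p─q⇔ x∈p─q))) (x∈⁅x⁆ u))
    (λ {x} x∈⁅u⁆ → Equivalence.from x∈p─q⇔ (Equivalence.from (p─q≡u x) (x∈⁅y⁆⇒x≡y u x∈⁅u⁆)))

𝟙 : Bool → ℕ
𝟙 true = 1
𝟙 false = 0

∣p∣≡∑𝟙 : ∀ (p : Subset n) → ∣ p ∣ ≡ ∑[ x < n ] 𝟙 (lookup p x)
∣p∣≡∑𝟙 [] = refl
∣p∣≡∑𝟙 (inside ∷ p) = cong suc (∣p∣≡∑𝟙 p)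
∣p∣≡∑𝟙 (outside ∷ p) = ∣p∣≡∑𝟙 p

𝟙a*∣p∣≡∑𝟙[a∧p] : ∀ a (p : Subset n) → 𝟙 a * ∣ p ∣ ≡ ∑[ x < n ] 𝟙 (a ∧ lookup p x)
𝟙a*∣p∣≡∑𝟙[a∧p] true p = trans (+-identityʳ ∣ p ∣) (∣p∣≡∑𝟙 p)
𝟙a*∣p∣≡∑𝟙[a∧p] {n} false p = sym (sum-replicate-zero n)

∑-mono-≤ : ∀ {n} {f g : Fin n → ℕ} → (∀ x → f x ≤ g x) → ∑[ x < n ] f x ≤ ∑[ x < n ] g x
∑-mono-≤ {zero} f≤g = z≤n
∑-mono-≤ {suc n} f≤g = +-mono-≤ (f≤g zero) (∑-mono-≤ (f≤g ∘ suc))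

∑𝟙-mono-≤ : ∀ (p : Subset n) {f g : Fin n → ℕ} → (∀ {x} → x ∈ p → f x ≤ g x) →
            ∑[ x < n ] (𝟙 (lookup p x) * f x) ≤ ∑[ x < n ] (𝟙 (lookup p x) * g x)
∑𝟙-mono-≤ p {f} {g} f≤g = ∑-mono-≤ pointwise
  where
  pointwise : ∀ x → 𝟙 (lookup p x) * f x ≤ 𝟙 (lookup p x) * g x
  pointwise x with lookup p x in x∈p
  ... | true = *-monoʳ-≤ 1 (f≤g (lookup⇒[]= x p x∈p))
  ... | false = z≤n

∣p∣*k≡∑𝟙*k : ∀ (p : Subset n) k → ∣ p ∣ * k ≡ ∑[ x < n ] (𝟙 (lookup p x) * k)
∣p∣*k≡∑𝟙*k p k = trans (cong (_* k) (∣p∣≡∑𝟙 p)) (*-distribʳ-sum k (𝟙 ∘ lookup p))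

swap : Subset n → Fin n → Fin n → Subset n
swap I u v = (I - u) ∪ ⁅ v ⁆

module _ {I : Subset n} {u v : Fin n} where

  ∈swap⁻ : x ∈ swap I u v → x ≡ v ⊎ (x ∈ I × x ≢ u)
  ∈swap⁻ x∈ with x∈p∪q⁻ (I - u) ⁅ v ⁆ x∈
  ... | inj₁ x∈I-u = inj₂ (p─q⊆p I ⁅ u ⁆ x∈I-u , x∈p-y⇒x≢y I x∈I-u)
  ... | inj₂ x∈⁅v⁆ = inj₁ (x∈⁅y⁆⇒x≡y v x∈⁅v⁆)

  ∈swap⁺ : x ∈ I → x ≢ u → x ∈ swap I u v
  ∈swap⁺ x∈I x≢u = x∈p∪q⁺ (inj₁ (x∈p∧x≢y⇒x∈p-y x∈I x≢u))

  v∈swap : v ∈ swap I u v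
  v∈swap = x∈p∪q⁺ (inj₂ (x∈⁅x⁆ v))

∣swap─q∣<∣p─q∣ : ∀ {p q : Subset n} {u v} → u ∈ p ─ q → v ∈ q → ∣ swap p u v ─ q ∣ < ∣ p ─ q ∣
∣swap─q∣<∣p─q∣ {p = p} {q} {u} {v} u∈p─q v∈q =
  ≤-<-trans (p⊆q⇒∣p∣≤∣q∣ swap─q⊆p─q-u) (x∈p⇒∣p-x∣<∣p∣ u∈p─q)
  where
  swap─q⊆p─q-u : swap p u v ─ q ⊆ p ─ q - u
  swap─q⊆p─q-u {x} x∈ with ∈swap⁻ (p─q⊆p (swap p u v) q x∈)
  ... | inj₁ refl = contradiction v∈q (x∈p─q⇒x∉q {p = swap p u v} x∈)
  ... | inj₂ (x∈p , x≢u) =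
    x∈p∧x≢y⇒x∈p-y (x∈p∧x∉q⇒x∈p─q x∈p (x∈p─q⇒x∉q {p = swap p u v} x∈)) x≢u

module _ {n : ℕ} (G : Graph n) where

  adjacent? : Fin n → Fin n → Bool
  adjacent? v w = does (adj-dec G v w)

  neighbours : Fin n → Subset n
  neighbours v = tabulate (adjacent? v)

  adjacent?-comm : ∀ v w → adjacent? v w ≡ adjacent? w v
  adjacent?-comm v w = does-⇔ (mk⇔ (adj-sym G) (adj-sym G)) (adj-dec G v w) (adj-dec G w v)

  lookup-∩neighbours : ∀ (p : Subset n) v w → lookup (p ∩ neighbours v) w ≡ lookup p w ∧ adjacent? v w
  lookup-∩neighbours p v w =
    trans (lookup-zipWith _∧_ w p (neighbours v)) (cong (lookup p w ∧_) (lookup∘tabulate (adjacent? v) w))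

  ∈neighbours⁻ : ∀ {v w} → w ∈ neighbours v → Adj G v w
  ∈neighbours⁻ {v} {w} w∈ with adj-dec G v w | trans (sym (lookup∘tabulate (adjacent? v) w)) ([]=⇒lookup w∈)
  ... | yes adj | _ = adj
  ... | no _ | ()

  ∈neighbours⁺ : ∀ {v w} → Adj G v w → w ∈ neighbours v
  ∈neighbours⁺ {v} {w} adj =
    lookup⇒[]= w (neighbours v) (trans (lookup∘tabulate (adjacent? v) w) (dec-true (adj-dec G v w) adj))

  edges : Subset n → Subset n → ℕ
  edges A B = ∑[ v < n ] (𝟙 (lookup A v) * ∣ B ∩ neighbours v ∣)

  edges-comm : ∀ A B → edges A B ≡ edges B A
  edges-comm A B = begin
    edges A B                          ≡⟨ sum-cong-≗ (λ v → 𝟙a*∣p∣≡∑𝟙[a∧p] (lookup A v) (B ∩ neighbours v)) ⟩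
    ∑[ v < n ] ∑[ w < n ] pair A B v w ≡⟨ ∑-comm (pair A B) ⟩
    ∑[ w < n ] ∑[ v < n ] pair A B v w ≡⟨ sum-cong-≗ (λ w → sum-cong-≗ (λ v → cong 𝟙 (exchange v w))) ⟩
    ∑[ w < n ] ∑[ v < n ] pair B A w v ≡⟨ sum-cong-≗ (λ w → 𝟙a*∣p∣≡∑𝟙[a∧p] (lookup B w) (A ∩ neighbours w)) ⟨
    edges B A                          ∎
    where
    open ≡-Reasoning
    pair : Subset n → Subset n → Fin n → Fin n → ℕ
    pair A B v w = 𝟙 (lookup A v ∧ lookup (B ∩ neighbours v) w)
    exchange : ∀ v w → lookup A v ∧ lookup (B ∩ neighbours v) w ≡ lookup B w ∧ lookup (A ∩ neighbours w) v
    exchange v w = begin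
      lookup A v ∧ lookup (B ∩ neighbours v) w  ≡⟨ cong (lookup A v ∧_) (lookup-∩neighbours B v w) ⟩
      lookup A v ∧ (lookup B w ∧ adjacent? v w) ≡⟨ ∧-assoc (lookup A v) _ _ ⟨
      (lookup A v ∧ lookup B w) ∧ adjacent? v w ≡⟨ cong₂ _∧_ (∧-comm (lookup A v) _) (adjacent?-comm v w) ⟩
      (lookup B w ∧ lookup A v) ∧ adjacent? w v ≡⟨ ∧-assoc (lookup B w) _ _ ⟩
      lookup B w ∧ (lookup A v ∧ adjacent? w v) ≡⟨ cong (lookup B w ∧_) (lookup-∩neighbours A w v) ⟨
      lookup B w ∧ lookup (A ∩ neighbours w) v  ∎

  edges-lower : ∀ k A B → (∀ {v} → v ∈ A → k ≤ ∣ B ∩ neighbours v ∣) → ∣ A ∣ * k ≤ edges A B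
  edges-lower k A B k≤deg = ≤-trans (≤-reflexive (∣p∣*k≡∑𝟙*k A k)) (∑𝟙-mono-≤ A k≤deg)

  edges-upper : ∀ k A B → (∀ {v} → v ∈ A → ∣ B ∩ neighbours v ∣ ≤ k) → edges A B ≤ ∣ A ∣ * k
  edges-upper k A B deg≤k = ≤-trans (∑𝟙-mono-≤ A deg≤k) (≤-reflexive (sym (∣p∣*k≡∑𝟙*k A k)))

  independent-⊆ : ∀ {p q} → p ⊆ q → Independent G q → Independent G p
  independent-⊆ p⊆q indep x∈p y∈p = indep (p⊆q x∈p) (p⊆q y∈p)

  ∣S∩neighbours∣≤2 : ClawFree G → ∀ {S} → Independent G S → ∀ w → ∣ S ∩ neighbours w ∣ ≤ 2
  ∣S∩neighbours∣≤2 clawFree {S} indep w = s≤s⁻¹ (≰⇒> no-claw)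
    where
    no-claw : ¬ 3 ≤ ∣ S ∩ neighbours w ∣
    no-claw 3≤∣S∩N∣ =
      let a , b , c , a∈ , b∈ , c∈ , a≢b , a≢c , b≢c = 3≤∣p∣⇒three-distinct (S ∩ neighbours w) 3≤∣S∩N∣
          a∈S , wa = x∈p∩q⁻ S (neighbours w) a∈
          b∈S , wb = x∈p∩q⁻ S (neighbours w) b∈
          c∈S , wc = x∈p∩q⁻ S (neighbours w) c∈
      in clawFree w a b c (∈neighbours⁻ wa) (∈neighbours⁻ wb) (∈neighbours⁻ wc)
                          (indep a∈S b∈S) (indep a∈S c∈S) (indep b∈S c∈S) a≢b a≢c b≢c

  independent? : ∀ K → Dec (Independent G K)
  independent? K = map′ (λ indep {x} {y} → indep x y) (λ indep x y → indep)
    (all? λ x → all? λ y → x ∈? K →-dec (y ∈? K →-dec ¬? (adj-dec G x y)))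

  ¬maximum⇒larger : ∀ {I} → Independent G I → ¬ MaximumIndependent G I →
                    ∃ λ K → Independent G K × ∣ I ∣ < ∣ K ∣
  ¬maximum⇒larger {I} indI ¬maximum with anySubset? (λ K → independent? K ×-dec ∣ I ∣ <? ∣ K ∣)
  ... | yes larger = larger
  ... | no ¬larger = ⊥-elim (¬maximum (indI , λ K indK → ≮⇒≥ λ ∣I∣<∣K∣ → ¬larger (K , indK , ∣I∣<∣K∣)))

  swap-TJStep : ∀ {I u v} → Independent G I → u ∈ I → v ∉ I →
                (∀ {w} → w ∈ I → Adj G v w → w ≡ u) → TJStep G I (swap I u v)
  swap-TJStep {I} {u} {v} indep u∈I v∉I only-u =
    indep , indep-swap , u , v , (λ x → mk⇔ (left x) λ { refl → u∈I , u∉swap }) ,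
                                 (λ x → mk⇔ entered λ { refl → v∈swap , v∉I })
    where
    indep-swap : Independent G (swap I u v)
    indep-swap x∈ y∈ adj with ∈swap⁻ x∈ | ∈swap⁻ y∈
    ... | inj₁ refl | inj₁ refl = adj-irr G adj
    ... | inj₁ refl | inj₂ (y∈I , y≢u) = y≢u (only-u y∈I adj)
    ... | inj₂ (x∈I , x≢u) | inj₁ refl = x≢u (only-u x∈I (adj-sym G adj))
    ... | inj₂ (x∈I , _) | inj₂ (y∈I , _) = indep x∈I y∈I adj
    u∉swap : u ∉ swap I u v
    u∉swap u∈ with ∈swap⁻ u∈
    ... | inj₁ refl = v∉I u∈I
    ... | inj₂ (_ , u≢u) = u≢u refl
    left : ∀ x → x ∈ I × x ∉ swap I u v → x ≡ u
    left x (x∈I , x∉) with x ≟ u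
    ... | yes x≡u = x≡u
    ... | no x≢u = contradiction (∈swap⁺ x∈I x≢u) x∉
    entered : ∀ {x} → x ∈ swap I u v × x ∉ I → x ≡ v
    entered (x∈ , x∉I) with ∈swap⁻ x∈
    ... | inj₁ x≡v = x≡v
    ... | inj₂ (x∈I , _) = contradiction x∈I x∉I

  TJStep-sym : ∀ {I J} → TJStep G I J → TJStep G J I
  TJStep-sym (indI , indJ , u , v , left , entered) = indJ , indI , v , u , entered , left

  TJStep⇒∣I∣≡∣J∣ : ∀ {I J} → TJStep G I J → ∣ I ∣ ≡ ∣ J ∣
  TJStep⇒∣I∣≡∣J∣ {I} {J} (_ , _ , _ , _ , left , entered) = +-cancelʳ-≡ 1 _ _ (begin
    ∣ I ∣ + 1         ≡⟨ cong (∣ I ∣ +_) (∣p─q∣≡1 J I entered) ⟨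
    ∣ I ∣ + ∣ J ─ I ∣ ≡⟨ ∣p∣+∣q─p∣≡∣q∣+∣p─q∣ I J ⟩
    ∣ J ∣ + ∣ I ─ J ∣ ≡⟨ cong (∣ J ∣ +_) (∣p─q∣≡1 I J left) ⟩
    ∣ J ∣ + 1         ∎)
    where open ≡-Reasoning

  TJReachable⇒∣I∣≡∣J∣ : ∀ {I J} → TJReachable G I J → ∣ I ∣ ≡ ∣ J ∣
  TJReachable⇒∣I∣≡∣J∣ ε = refl
  TJReachable⇒∣I∣≡∣J∣ (step ◅ steps) = trans (TJStep⇒∣I∣≡∣J∣ step) (TJReachable⇒∣I∣≡∣J∣ steps)

module Approach {n : ℕ} (G : Graph n) (clawFree : ClawFree G) {T : Subset n} (indT : Independent G T) where

  Compatible : Subset n → Set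
  Compatible I = ∀ {x y} → x ∈ I → y ∈ T → ¬ Adj G x y

  Approaches : Subset n → Set
  Approaches I = ∣ I ∣ < ∣ T ∣ ⊎ (∣ I ∣ ≡ ∣ T ∣ × Compatible I)

  JumpTowards : Subset n → Set
  JumpTowards I = ∃₂ λ u v → u ∈ I ─ T × v ∈ T ─ I × (∀ {w} → w ∈ I → Adj G v w → w ≡ u)

  sparse-vertex : ∀ {I} → ∣ I ∣ < ∣ T ∣ → ∃ λ v → v ∈ T ─ I × ∣ (I ─ T) ∩ neighbours G v ∣ ≤ 1
  sparse-vertex {I} ∣I∣<∣T∣ with any? (λ v → v ∈? T ─ I ×-dec ∣ (I ─ T) ∩ neighbours G v ∣ ≤? 1)
  ... | yes sparse = sparse
  ... | no ¬sparse = contradiction (∣p∣<∣q∣⇒∣p─q∣<∣q─p∣ I T ∣I∣<∣T∣) (≤⇒≯ ∣T─I∣≤∣I─T∣)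
    where
    dense : ∀ {v} → v ∈ T ─ I → 2 ≤ ∣ (I ─ T) ∩ neighbours G v ∣
    dense {v} v∈ = ≰⇒> λ sparse → ¬sparse (v , v∈ , sparse)
    ∣T─I∣≤∣I─T∣ : ∣ T ─ I ∣ ≤ ∣ I ─ T ∣
    ∣T─I∣≤∣I─T∣ = *-cancelʳ-≤ _ _ 2 (begin
      ∣ T ─ I ∣ * 2               ≤⟨ edges-lower G 2 (T ─ I) (I ─ T) dense ⟩
      edges G (T ─ I) (I ─ T)     ≡⟨ edges-comm G (T ─ I) (I ─ T) ⟩
      edges G (I ─ T) (T ─ I)     ≤⟨ edges-upper G 2 (I ─ T) (T ─ I) (λ {w} _ →
                                       ∣S∩neighbours∣≤2 G clawFree (independent-⊆ G (p─q⊆p T I) indT) w) ⟩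
      ∣ I ─ T ∣ * 2               ∎)
      where open ≤-Reasoning

  jump-to : ∀ {I v} → v ∈ T ─ I → ∣ (I ─ T) ∩ neighbours G v ∣ ≤ 1 → Nonempty (I ─ T) → JumpTowards I
  jump-to {I} {v} v∈T─I sparse (u₀ , u₀∈I─T) with nonempty? (I ∩ neighbours G v)
  ... | yes (u , u∈I∩N) = u , v , near u∈I u-adj , v∈T─I , only-u
    where
    u∈I = proj₁ (x∈p∩q⁻ I (neighbours G v) u∈I∩N)
    u-adj = ∈neighbours⁻ G (proj₂ (x∈p∩q⁻ I (neighbours G v) u∈I∩N))
    near : ∀ {w} → w ∈ I → Adj G v w → w ∈ I ─ T
    near w∈I adj = x∈p∧x∉q⇒x∈p─q w∈I λ w∈T → indT (p─q⊆p T I v∈T─I) w∈T adj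
    only-u : ∀ {w} → w ∈ I → Adj G v w → w ≡ u
    only-u w∈I adj = ∣p∣≤1⇒x≡y ((I ─ T) ∩ neighbours G v) sparse
      (x∈p∩q⁺ (near w∈I adj , ∈neighbours⁺ G adj)) (x∈p∩q⁺ (near u∈I u-adj , ∈neighbours⁺ G u-adj))
  ... | no no-neighbour = u₀ , v , u₀∈I─T , v∈T─I ,
    λ {w} w∈I adj → ⊥-elim (no-neighbour (w , x∈p∩q⁺ (w∈I , ∈neighbours⁺ G adj)))

  jump : ∀ {I} → Approaches I → Nonempty (I ─ T) → JumpTowards I
  jump (inj₁ ∣I∣<∣T∣) I⊈T =
    let v , v∈T─I , sparse = sparse-vertex ∣I∣<∣T∣ in jump-to v∈T─I sparse I⊈T
  jump {I} (inj₂ (∣I∣≡∣T∣ , compatible)) I⊈T@(u , u∈I─T) =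
    let v , v∈T─I = ∣p∣>0⇒Nonempty (subst (0 <_) (∣p∣≡∣q∣⇒∣p─q∣≡∣q─p∣ I T ∣I∣≡∣T∣) (x∈p⇒0<∣p∣ (I ─ T) u∈I─T))
    in jump-to v∈T─I (subst (_≤ 1) (sym (no-edges v∈T─I)) z≤n) I⊈T
    where
    no-edges : ∀ {v} → v ∈ T ─ I → ∣ (I ─ T) ∩ neighbours G v ∣ ≡ 0
    no-edges {v} v∈T─I = Empty⇒∣p∣≡0 λ (w , w∈) →
      let w∈I─T , w∈N = x∈p∩q⁻ (I ─ T) (neighbours G v) w∈
      in compatible (p─q⊆p I T w∈I─T) (p─q⊆p T I v∈T─I) (adj-sym G (∈neighbours⁻ G w∈N))

  swap-approaches : ∀ {I u v} → v ∈ T → ∣ swap I u v ∣ ≡ ∣ I ∣ → Approaches I → Approaches (swap I u v)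
  swap-approaches v∈T same-size (inj₁ ∣I∣<∣T∣) = inj₁ (subst (_< ∣ T ∣) (sym same-size) ∣I∣<∣T∣)
  swap-approaches {I} {u} {v} v∈T same-size (inj₂ (∣I∣≡∣T∣ , compatible)) =
    inj₂ (trans same-size ∣I∣≡∣T∣ , compatible′)
    where
    compatible′ : Compatible (swap I u v)
    compatible′ x∈ y∈T with ∈swap⁻ x∈
    ... | inj₁ refl = indT v∈T y∈T
    ... | inj₂ (x∈I , _) = compatible x∈I y∈T

  approach : ∀ {I} → Independent G I → Approaches I → ∃ λ I′ → TJReachable G I I′ × I′ ⊆ T
  approach {I} = go I (<-wellFounded ∣ I ─ T ∣)
    where
    go : ∀ I → Acc _<_ ∣ I ─ T ∣ → Independent G I → Approaches I →
         ∃ λ I′ → TJReachable G I I′ × I′ ⊆ T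
    go I (acc smaller) indI approaches with nonempty? (I ─ T)
    ... | no I─T≡∅ = I , ε , Empty[p─q]⇒p⊆q I T I─T≡∅
    ... | yes I⊈T =
      let u , v , u∈I─T , v∈T─I , only-u = jump approaches I⊈T
          v∈T = p─q⊆p T I v∈T─I
          step = swap-TJStep G indI (p─q⊆p I T u∈I─T) (x∈p─q⇒x∉q {p = T} v∈T─I) only-u
          I′ , path , I′⊆T = go (swap I u v) (smaller (∣swap─q∣<∣p─q∣ u∈I─T v∈T)) (proj₁ (proj₂ step))
                                (swap-approaches v∈T (sym (TJStep⇒∣I∣≡∣J∣ G step)) approaches)
      in I′ , step ◅ path , I′⊆T

lemma8 : ∀ {n : ℕ} (G : Graph n) → ClawFree G →
         ∀ (I : Subset n) → Independent G I → ¬ MaximumIndependent G I →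
         ∀ (J : Subset n) → Independent G J → ∣ J ∣ ≡ ∣ I ∣ →
         TJReachable G I J
lemma8 G clawFree I indI ¬maximum J indJ ∣J∣≡∣I∣ =
  let K , indK , ∣I∣<∣K∣ = ¬maximum⇒larger G indI ¬maximum
      I₁ , I⇝I₁ , I₁⊆K = approach indK indI (inj₁ ∣I∣<∣K∣)
      J₁ , J⇝J₁ , J₁⊆K = approach indK indJ (inj₁ (subst (_< ∣ K ∣) (sym ∣J∣≡∣I∣) ∣I∣<∣K∣))
      ∣I₁∣≡∣J₁∣ = begin
        ∣ I₁ ∣ ≡⟨ TJReachable⇒∣I∣≡∣J∣ G I⇝I₁ ⟨
        ∣ I ∣  ≡⟨ ∣J∣≡∣I∣ ⟨
        ∣ J ∣  ≡⟨ TJReachable⇒∣I∣≡∣J∣ G J⇝J₁ ⟩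
        ∣ J₁ ∣ ∎
  in I⇝I₁ ◅◅ within indK I₁⊆K J₁⊆K ∣I₁∣≡∣J₁∣ ◅◅ reverse (TJStep-sym G) J⇝J₁
  where
  open Approach G clawFree using (approach)
  open ≡-Reasoning
  within : ∀ {K I J} → Independent G K → I ⊆ K → J ⊆ K → ∣ I ∣ ≡ ∣ J ∣ → TJReachable G I J
  within {K} {I} {J} indK I⊆K J⊆K ∣I∣≡∣J∣ =
    let I′ , I⇝I′ , I′⊆J = approach (independent-⊆ G J⊆K indK) (independent-⊆ G I⊆K indK)
                             (inj₂ (∣I∣≡∣J∣ , λ x∈I y∈J → indK (I⊆K x∈I) (J⊆K y∈J)))
        I′≡J = p⊆q⇒∣p∣≡∣q∣⇒p≡q I′ J I′⊆J (trans (sym (TJReachable⇒∣I∣≡∣J∣ G I⇝I′)) ∣I∣≡∣J∣)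
    in subst (TJReachable G I) I′≡J I⇝I′
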